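{- For every $\phi\in\mathcal L_{\mathsf{Ldm}}$ and every label $x$: if $\vdash_{\mathsf{Ldm}}\phi$, then the labelled sequent $x:\phi$ is derivable in $\mathsf{G3Ldm}$.
   Context: Fix a finite set of agents $Ag=\{1,\dots,n\}$ and a countable set $Var$ of propositional variables. $\mathcal{L}_{\mathsf{Ldm}}$ (negation normal form): $\phi ::= p \mid \overline{p} \mid \phi\wedge\phi \mid \phi\vee\phi \mid \Box\phi \mid \Diamond\phi \mid [i]\phi \mid \langle i\rangle\phi$, $p\in Var$, $i\in Ag$. $\overline\phi$ is obtained by swapping each operator with its dual ($\wedge/\vee$, $\Box/\Diamond$, $[i]/\langle i\rangle$) and $p$ with $\overline p$; $\phi\to\psi:=\overline\phi\vee\psi$, $\bot := p\wedge\overline p$. Hilbert system $\mathsf{Ldm}$: axioms $\phi\to(\psi\to\phi)$; $(\overline\psi\to\overline\phi)\to(\phi\to\psi)$; $(\phi\to(\psi\to\chi))\to((\phi\to\psi)\to(\phi\to\chi))$; $\Box\phi\to\phi$; $\Diamond\phi\to\Box\Diamond\phi$; $\Box(\phi\to\psi)\to(\Box\phi\to\Box\psi)$; $[i]\phi\to\phi$; $\langle i\rangle\phi\to[i]\langle i\rangle\phi$; $\Box\phi\vee\Diamond\overline\phi$; $[i]\phi\vee\langle i\rangle\overline\phi$; $\bigwedge_{i\in Ag}\Diamond[i]\phi_i\to\Diamond(\bigwedge_{i\in Ag}[i]\phi_i)$; $[i](\phi\to\psi)\to([i]\phi\to[i]\psi)$; $\Box\phi\to[i]\phi$; rules: from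 $\phi$ infer $\Box\phi$; modus ponens. $\vdash_{\mathsf{Ldm}}\phi$: $\phi$ is a theorem. Labelled sequents: multisets built by $\Gamma ::= x:\phi \mid \Gamma,\Gamma \mid \mathcal{R}_\alpha xy,\Gamma$, labels from a countable set, $\phi\in\mathcal L_{\mathsf{Ldm}}$, $\alpha\in\{\Box\}\cup Ag$. Rules of $\mathsf{G3Ldm}$: (id) $\Gamma,w:p,w:\overline p$ is an axiom; ($\wedge$) from $\Gamma,w:\phi$ and $\Gamma,w:\psi$ infer $\Gamma,w:\phi\wedge\psi$; ($\vee$) from $\Gamma,w:\phi,w:\psi$ infer $\Gamma,w:\phi\vee\psi$; ($\Box$) from $\Gamma,\mathcal R_\Box wv,v:\phi$ infer $\Gamma,w:\Box\phi$; ($\Diamond$) from $\Gamma,\mathcal R_\Box wu,w:\Diamond\phi,u:\phi$ infer $\Gamma,\mathcal R_\Box wu,w:\Diamond\phi$; ($[i]$) from $\Gamma,\mathcal R_iwv,v:\phi$ infer $\Gamma,w:[i]\phi$; ($\langle i\rangle$) from $\Gamma,\mathcal R_iwu,w:\langle i\rangle\phi,u:\phi$ infer $\Gamma,\mathcal R_iwu,w:\langle i\rangle\phi$; ($\mathsf{refl}_\Box$) from $\mathcal R_\Box ww,\Gamma$ infer $\Gamma$; ($\mathsf{refl}_{[i]}$) from $\mathcal R_iww,\Gamma$ infer $\Gamma$; ($\mathsf{IOA}$) from $\mathcal R_\Box wu_1,\dots,\mathcal R_\Box wu_n,\mathcal R_1u_1v,\dots,\mathcal R_nu_nv,\Gamma$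 infer $\mathcal R_\Box wu_1,\dots,\mathcal R_\Box wu_n,\Gamma$; ($\mathsf{eucl}_\Box$) from $\mathcal R_\Box wu,\mathcal R_\Box wv,\mathcal R_\Box uv,\Gamma$ infer $\mathcal R_\Box wu,\mathcal R_\Box wv,\Gamma$; ($\mathsf{br}_{[i]}$) from $\mathcal R_\Box wu,\mathcal R_iwu,\Gamma$ infer $\mathcal R_iwu,\Gamma$; ($\mathsf{eucl}_{[i]}$) from $\mathcal R_iwu,\mathcal R_iwv,\mathcal R_iuv,\Gamma$ infer $\mathcal R_iwu,\mathcal R_iwv,\Gamma$. In ($\Box$), ($[i]$), ($\mathsf{IOA}$) the label $v$ must not occur in the conclusion. The calculus also contains, for each rule where a substitution of labels duplicates active relational atoms, the instance with the duplicates contracted. A sequent is derivable if it is the root of a finite tree of rule applications whose leaves are instances of (id). -}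

module Defs where

open import Data.Nat using (ℕ; zero; suc)
open import Data.Fin using (Fin)
open import Data.List using (List; []; _∷_; _++_; map)
open import Data.List.Membership.Propositional using (_∈_)
open import Data.List.Relation.Unary.Any using (Any)
open import Data.List.Relation.Binary.Permutation.Propositional using (_↭_)
open import Data.Fin.Base using (zero; suc)
open import Data.List using () renaming (tabulate to ltabulate)
open import Relation.Binary.PropositionalEquality using (_≡_)
open import Relation.Nullary using (¬_)

-- Formulas of L_Ldm in negation normal form

data Fm (n : ℕ) : Set where
  var  : ℕ → Fm n
  nvar : ℕ → Fm n
  _∧_  : Fm n → Fm n → Fm n
  _∨_  : Fm n → Fm n → Fm n
  □    : Fm n → Fm n
  ◇    : Fm n → Fm n
  [_]  : Fin n → Fm n → Fm n
  ⟨_⟩  : Fin n → Fm n → Fm n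

infixr 6 _∧_
infixr 5 _∨_

neg : ∀ {n} → Fm n → Fm n
neg (var p)   = nvar p
neg (nvar p)  = var p
neg (φ ∧ ψ)   = neg φ ∨ neg ψ
neg (φ ∨ ψ)   = neg φ ∧ neg ψ
neg (□ φ)     = ◇ (neg φ)
neg (◇ φ)     = □ (neg φ)
neg ([ i ] φ) = ⟨ i ⟩ (neg φ)
neg (⟨ i ⟩ φ) = [ i ] (neg φ)

_⇒_ : ∀ {n} → Fm n → Fm n → Fm n
φ ⇒ ψ = neg φ ∨ ψ

infixr 4 _⇒_

-- ⊤ (used only as the empty conjunction when n = 0): p₀ ∨ \overline p₀
⊤f : ∀ {n} → Fm n
⊤f = var 0 ∨ nvar 0

bigAnd : ∀ {n} (k : ℕ) → (Fin k → Fm n) → Fm n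
bigAnd zero          f = ⊤f
bigAnd (suc zero)    f = f zero
bigAnd (suc (suc k)) f = f zero ∧ bigAnd (suc k) (λ i → f (suc i))

data Thm {n : ℕ} : Fm n → Set where
  ax1    : ∀ φ ψ → Thm (φ ⇒ (ψ ⇒ φ))
  ax2    : ∀ φ ψ → Thm ((neg ψ ⇒ neg φ) ⇒ (φ ⇒ ψ))
  ax3    : ∀ φ ψ χ → Thm ((φ ⇒ (ψ ⇒ χ)) ⇒ ((φ ⇒ ψ) ⇒ (φ ⇒ χ)))
  axT□   : ∀ φ → Thm (□ φ ⇒ φ)
  ax5□   : ∀ φ → Thm (◇ φ ⇒ □ (◇ φ))
  axK□   : ∀ φ ψ → Thm (□ (φ ⇒ ψ) ⇒ (□ φ ⇒ □ ψ))
  axTi   : ∀ i φ → Thm ([ i ] φ ⇒ φ)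
  ax5i   : ∀ i φ → Thm (⟨ i ⟩ φ ⇒ [ i ] (⟨ i ⟩ φ))
  axD□   : ∀ φ → Thm (□ φ ∨ ◇ (neg φ))
  axDi   : ∀ i φ → Thm ([ i ] φ ∨ ⟨ i ⟩ (neg φ))
  axIOA  : ∀ (φs : Fin n → Fm n) →
           Thm (bigAnd n (λ i → ◇ ([ i ] (φs i))) ⇒ ◇ (bigAnd n (λ i → [ i ] (φs i))))
  axKi   : ∀ i φ ψ → Thm ([ i ] (φ ⇒ ψ) ⇒ ([ i ] φ ⇒ [ i ] ψ))
  axSett : ∀ i φ → Thm (□ φ ⇒ [ i ] φ)
  nec    : ∀ {φ} → Thm φ → Thm (□ φ)
  mp     : ∀ {φ ψ} → Thm (φ ⇒ ψ) → Thm φ → Thm ψ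

data Rel (n : ℕ) : Set where
  rbox : Rel n
  rag  : Fin n → Rel n

data Item (n : ℕ) : Set where
  lab : ℕ → Fm n → Item n
  rel : Rel n → ℕ → ℕ → Item n

-- a sequent is a multiset, represented by a list up to permutation
Seq : ℕ → Set
Seq n = List (Item n)

data OccIn {n : ℕ} (v : ℕ) : Item n → Set where
  inLab  : ∀ φ → OccIn v (lab v φ)
  inRel₁ : ∀ α y → OccIn v (rel α v y)
  inRel₂ : ∀ α x → OccIn v (rel α x v)

Fresh : ∀ {n} → ℕ → Seq n → Set
Fresh v Γ = ¬ Any (OccIn v) Γ

-- Principal formulas are at the head of the list;
-- the structural rule 'perm' makes sequents multisets.  Relational atoms
-- that are active but retained in the conclusion are required by membership
-- (this includes all contracted instances).
data G3 {n : ℕ} : Seq n → Set where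
  perm   : ∀ {Γ Δ} → Γ ↭ Δ → G3 Γ → G3 Δ
  id     : ∀ {Γ} w p → G3 (lab w (var p) ∷ lab w (nvar p) ∷ Γ)
  ∧R     : ∀ {Γ} w φ ψ → G3 (lab w φ ∷ Γ) → G3 (lab w ψ ∷ Γ) → G3 (lab w (φ ∧ ψ) ∷ Γ)
  ∨R     : ∀ {Γ} w φ ψ → G3 (lab w φ ∷ lab w ψ ∷ Γ) → G3 (lab w (φ ∨ ψ) ∷ Γ)
  □R     : ∀ {Γ} w v φ → Fresh v (lab w (□ φ) ∷ Γ) →
           G3 (rel rbox w v ∷ lab v φ ∷ Γ) → G3 (lab w (□ φ) ∷ Γ)
  ◇R     : ∀ {Γ} w u φ → rel rbox w u ∈ Γ → lab w (◇ φ) ∈ Γ →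
           G3 (lab u φ ∷ Γ) → G3 Γ
  [i]R   : ∀ {Γ} i w v φ → Fresh v (lab w ([ i ] φ) ∷ Γ) →
           G3 (rel (rag i) w v ∷ lab v φ ∷ Γ) → G3 (lab w ([ i ] φ) ∷ Γ)
  ⟨i⟩R   : ∀ {Γ} i w u φ → rel (rag i) w u ∈ Γ → lab w (⟨ i ⟩ φ) ∈ Γ →
           G3 (lab u φ ∷ Γ) → G3 Γ
  refl□  : ∀ {Γ} w → G3 (rel rbox w w ∷ Γ) → G3 Γ
  refl[i] : ∀ {Γ} i w → G3 (rel (rag i) w w ∷ Γ) → G3 Γ
  IOA    : ∀ {Γ} w (u : Fin n → ℕ) v →
           (∀ i → rel rbox w (u i) ∈ Γ) → Fresh v Γ →
           G3 (ltabulate (λ i → rel (rag i) (u i) v) ++ Γ) → G3 Γ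
  eucl□  : ∀ {Γ} w u v → rel rbox w u ∈ Γ → rel rbox w v ∈ Γ →
           G3 (rel rbox u v ∷ Γ) → G3 Γ
  br[i]  : ∀ {Γ} i w u → rel (rag i) w u ∈ Γ →
           G3 (rel rbox w u ∷ Γ) → G3 Γ
  eucl[i] : ∀ {Γ} i w u v → rel (rag i) w u ∈ Γ → rel (rag i) w v ∈ Γ →
           G3 (rel (rag i) u v ∷ Γ) → G3 Γ

module Submission where

open import Data.Nat using (ℕ)
open import Data.List using ([]; _∷_)
open import Defs

open import Data.Nat using (zero; suc; _≤_; _⊔_; _+_; z≤n; s≤s; _≟_)
import Data.Nat.Properties as ℕₚ
open import Data.Fin using (Fin) renaming (zero to fzero; suc to fsuc)
open import Data.List using (List; _++_; map; tabulate)
import Data.List.Properties as Listₚ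
open import Data.List.Relation.Unary.Any using (Any; here; there; _─_)
open import Data.List.Membership.Propositional using (_∈_; find; lose)
open import Data.List.Membership.Propositional.Properties
  using (∈-++⁺ˡ; ∈-++⁺ʳ; ∈-map⁺; ∈-tabulate⁺)
open import Data.List.Relation.Binary.Permutation.Propositional
  using (_↭_; prep; swap; ↭-sym; ↭-trans; ↭-refl)
open import Data.List.Relation.Binary.Permutation.Propositional.Properties
  using (∈-resp-↭; Any-resp-↭; drop-∷; shift; shifts; ++-comm; ++⁺ʳ; ++⁺ˡ; map⁺)
open import Data.Product using (∃; _×_; _,_)
open import Data.Sum using (_⊎_; inj₁; inj₂)
open import Data.Unit using (⊤; tt)
open import Data.Empty using (⊥; ⊥-elim)
open import Relation.Nullary using (yes; no; ¬_)
open import Relation.Binary.PropositionalEquality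
  using (_≡_; _≢_; refl; sym; trans; cong; cong₂; subst; module ≡-Reasoning)

-- Each axiom receives an
-- explicit cut-free G3Ldm derivation (the interaction axiom IOA uses the rule
-- (IOA) together with the relational rules), necessitation is one (□)-step
-- followed by weakening, and modus ponens needs the admissibility of cut.

module _ {A : Set} where

  #0 : ∀ {a : A} {xs} → a ∈ a ∷ xs
  #0 = here refl

  #1 : ∀ {a b : A} {xs} → a ∈ b ∷ a ∷ xs
  #1 = there #0

  #2 : ∀ {a b c : A} {xs} → a ∈ b ∷ c ∷ a ∷ xs
  #2 = there #1

  #3 : ∀ {a b c d : A} {xs} → a ∈ b ∷ c ∷ d ∷ a ∷ xs
  #3 = there #2

  #4 : ∀ {a b c d e : A} {xs} → a ∈ b ∷ c ∷ d ∷ e ∷ a ∷ xs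
  #4 = there #3

  ∈-≡ : ∀ {a b : A} {xs} → a ≡ b → a ∈ xs → b ∈ xs
  ∈-≡ refl m = m

  remove-↭ : ∀ {a : A} {xs} (a∈xs : a ∈ xs) → xs ↭ a ∷ (xs ─ a∈xs)
  remove-↭ (here refl) = ↭-refl
  remove-↭ {xs = x ∷ _} (there a∈xs) = ↭-trans (prep x (remove-↭ a∈xs)) (swap x _ ↭-refl)

  ∈-↭-∷ : ∀ {y X : A} {Δ Γ} → y ∈ Δ → Δ ↭ X ∷ Γ → y ≡ X ⊎ y ∈ Γ
  ∈-↭-∷ m p with ∈-resp-↭ p m
  ... | here e = inj₁ e
  ... | there m′ = inj₂ m′

  ∈-↭-tail : ∀ {a X : A} {Δ Γ} → Δ ↭ X ∷ Γ → a ∈ Γ → a ∈ Δ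
  ∈-↭-tail p m = ∈-resp-↭ (↭-sym p) (there m)

  -- Comparing the principal item H of a rule with a distinguished item X:
  -- either they coincide, or X lies in the side sequent Θ and H in Γ.
  ∷-↭-∷ : ∀ {H X : A} {Θ Γ} → H ∷ Θ ↭ X ∷ Γ →
          (H ≡ X × Θ ↭ Γ) ⊎ ∃ λ Θ′ → Θ ↭ X ∷ Θ′ × Γ ↭ H ∷ Θ′
  ∷-↭-∷ {H} {X} p with ∈-resp-↭ (↭-sym p) #0
  ... | here refl = inj₁ (refl , drop-∷ p)
  ... | there m = inj₂ (_ , remove-↭ m , ↭-sym (drop-∷ X∷H∷Θ′↭X∷Γ))
    where X∷H∷Θ′↭X∷Γ = ↭-trans (swap X H ↭-refl) (↭-trans (prep H (↭-sym (remove-↭ m))) p)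

  ↭-under : ∀ {X a : A} {Θ Θ′} → Θ ↭ X ∷ Θ′ → a ∷ Θ ↭ X ∷ a ∷ Θ′
  ↭-under {X} {a} q = ↭-trans (prep a q) (swap a X ↭-refl)

  ↭-under-++ : ∀ {X : A} {Θ Θ′} T → Θ ↭ X ∷ Θ′ → T ++ Θ ↭ X ∷ T ++ Θ′
  ↭-under-++ [] q = q
  ↭-under-++ (a ∷ T) q = ↭-under (↭-under-++ T q)

  ∈-↭-dup : ∀ {y X : A} {Δ Γ} → y ∈ Δ → Δ ↭ X ∷ Γ → X ∈ Γ → y ∈ Γ
  ∈-↭-dup m p X∈Γ with ∈-↭-∷ m p
  ... | inj₁ refl = X∈Γ
  ... | inj₂ m′ = m′

  ∈-↭-other : ∀ {X H : A} {Γ Θ′} → X ∈ Γ → Γ ↭ H ∷ Θ′ → H ≢ X → X ∈ Θ′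
  ∈-↭-other X∈Γ r H≢X with ∈-resp-↭ r X∈Γ
  ... | here e = ⊥-elim (H≢X (sym e))
  ... | there m = m

module _ {n : ℕ} where

  maxLabelItem : Item n → ℕ
  maxLabelItem (lab x _) = x
  maxLabelItem (rel _ x y) = x ⊔ y

  maxLabel : Seq n → ℕ
  maxLabel [] = 0
  maxLabel (a ∷ Γ) = maxLabelItem a ⊔ maxLabel Γ

  occurs-≤ : ∀ {v Γ} → Any (OccIn v) Γ → v ≤ maxLabel Γ
  occurs-≤ {Γ = a ∷ Γ} (here o) = ℕₚ.≤-trans (item-≤ o) (ℕₚ.m≤m⊔n (maxLabelItem a) (maxLabel Γ))
    where
      item-≤ : ∀ {v a} → OccIn v a → v ≤ maxLabelItem a
      item-≤ (inLab φ) = ℕₚ.≤-refl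
      item-≤ (inRel₁ α y) = ℕₚ.m≤m⊔n _ y
      item-≤ (inRel₂ α x) = ℕₚ.m≤n⊔m x _
  occurs-≤ {Γ = a ∷ Γ} (there o) = ℕₚ.≤-trans (occurs-≤ o) (ℕₚ.m≤n⊔m (maxLabelItem a) (maxLabel Γ))

  fresh : Seq n → ℕ
  fresh Γ = suc (maxLabel Γ)

  fresh-Fresh : ∀ Γ → Fresh (fresh Γ) Γ
  fresh-Fresh Γ o = ℕₚ.<-irrefl refl (occurs-≤ o)

  Fresh-⊆ : ∀ {v} {Γ Δ : Seq n} → (∀ {a} → a ∈ Γ → a ∈ Δ) → Fresh v Δ → Fresh v Γ
  Fresh-⊆ Γ⊆Δ fr o with find o
  ... | a , m , occ = fr (lose (Γ⊆Δ m) occ)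

  Fresh-↭ : ∀ {v} {Γ Δ : Seq n} → Γ ↭ Δ → Fresh v Γ → Fresh v Δ
  Fresh-↭ p fr o = fr (Any-resp-↭ (↭-sym p) o)

  fresh≢label : ∀ {v w : ℕ} {φ : Fm n} {Γ : Seq n} → Fresh v Γ → lab w φ ∈ Γ → v ≢ w
  fresh≢label fr m refl = fr (lose m (inLab _))

  fresh≢target : ∀ {v w u : ℕ} {α : Rel n} {Γ : Seq n} → Fresh v Γ → rel α w u ∈ Γ → v ≢ u
  fresh≢target fr m refl = fr (lose m (inRel₂ _ _))

  rel-∈-↭ : ∀ {Δ Γ α w u x} {A : Fm n} → rel α w u ∈ Δ → Δ ↭ lab x A ∷ Γ → rel α w u ∈ Γ
  rel-∈-↭ m p with ∈-↭-∷ m p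
  ... | inj₂ m′ = m′

  Fresh-∷-tail : ∀ {v} {H X : Item n} {Θ Θ′} → Fresh v (H ∷ Θ) → Θ ↭ X ∷ Θ′ → Fresh v (H ∷ Θ′)
  Fresh-∷-tail fr q = Fresh-⊆ (λ { (here e) → here e ; (there m) → there (∈-↭-tail q m) }) fr

  id∈ : ∀ {Γ : Seq n} {w p} → lab w (var p) ∈ Γ → lab w (nvar p) ∈ Γ → G3 Γ
  id∈ m₁ m₂ with ∈-resp-↭ (remove-↭ m₁) m₂
  ... | there m′ = perm (↭-sym (↭-trans (remove-↭ m₁) (prep _ (remove-↭ m′)))) (id _ _)

  ∧R∈ : ∀ {Γ : Seq n} {w A B} (m : lab w (A ∧ B) ∈ Γ) →
        G3 (lab w A ∷ (Γ ─ m)) → G3 (lab w B ∷ (Γ ─ m)) → G3 Γ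
  ∧R∈ m d₁ d₂ = perm (↭-sym (remove-↭ m)) (∧R _ _ _ d₁ d₂)

  ∨R∈ : ∀ {Γ : Seq n} {w A B} (m : lab w (A ∨ B) ∈ Γ) → G3 (lab w A ∷ lab w B ∷ (Γ ─ m)) → G3 Γ
  ∨R∈ m d = perm (↭-sym (remove-↭ m)) (∨R _ _ _ d)

  □R∈ : ∀ {Γ : Seq n} {w A} (m : lab w (□ A) ∈ Γ) →
        (∀ v → G3 (rel rbox w v ∷ lab v A ∷ (Γ ─ m))) → G3 Γ
  □R∈ {Γ} m k = perm (↭-sym (remove-↭ m))
                  (□R _ (fresh Γ) _ (Fresh-↭ (remove-↭ m) (fresh-Fresh Γ)) (k (fresh Γ)))

  [i]R∈ : ∀ {Γ : Seq n} {w i A} (m : lab w ([ i ] A) ∈ Γ) →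
          (∀ v → G3 (rel (rag i) w v ∷ lab v A ∷ (Γ ─ m))) → G3 Γ
  [i]R∈ {Γ} m k = perm (↭-sym (remove-↭ m))
                    ([i]R _ _ (fresh Γ) _ (Fresh-↭ (remove-↭ m) (fresh-Fresh Γ)) (k (fresh Γ)))

  renameItem : (ℕ → ℕ) → Item n → Item n
  renameItem σ (lab x φ) = lab (σ x) φ
  renameItem σ (rel α x y) = rel α (σ x) (σ y)

  rename : (ℕ → ℕ) → Seq n → Seq n
  rename σ = map (renameItem σ)

  update : (ℕ → ℕ) → ℕ → ℕ → ℕ → ℕ
  update σ a b y with y ≟ a
  ... | yes _ = b
  ... | no _ = σ y

  update-same : ∀ σ a b → update σ a b a ≡ b
  update-same σ a b with a ≟ a
  ... | yes _ = refl
  ... | no a≢a = ⊥-elim (a≢a refl)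

  update-other : ∀ σ a b y → a ≢ y → update σ a b y ≡ σ y
  update-other σ a b y a≢y with y ≟ a
  ... | yes y≡a = ⊥-elim (a≢y (sym y≡a))
  ... | no _ = refl

  rename-cong : ∀ {σ τ : ℕ → ℕ} Γ → (∀ y → Any (OccIn y) Γ → σ y ≡ τ y) → rename σ Γ ≡ rename τ Γ
  rename-cong [] agree = refl
  rename-cong {σ} {τ} (a ∷ Γ) agree =
    cong₂ _∷_ (item a (λ y o → agree y (here o))) (rename-cong Γ (λ y o → agree y (there o)))
    where
      item : ∀ a → (∀ y → OccIn y a → σ y ≡ τ y) → renameItem σ a ≡ renameItem τ a
      item (lab x φ) agr = cong (λ z → lab z φ) (agr x (inLab φ))
      item (rel α x y) agr = cong₂ (rel α) (agr x (inRel₁ α y)) (agr y (inRel₂ α x))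

  rename-update-fresh : ∀ σ v b Γ → Fresh v Γ → rename (update σ v b) Γ ≡ rename σ Γ
  rename-update-fresh σ v b Γ fr =
    rename-cong Γ (λ y o → update-other σ v b y (λ v≡y → fr (subst (λ z → Any (OccIn z) Γ) (sym v≡y) o)))

  rename-id : ∀ (Γ : Seq n) → rename (λ x → x) Γ ≡ Γ
  rename-id [] = refl
  rename-id (lab x φ ∷ Γ) = cong (lab x φ ∷_) (rename-id Γ)
  rename-id (rel α x y ∷ Γ) = cong (rel α x y ∷_) (rename-id Γ)

  ∈-rename : ∀ {a Γ} σ Ξ → a ∈ Γ → renameItem σ a ∈ rename σ Γ ++ Ξ
  ∈-rename σ Ξ m = ∈-++⁺ˡ (∈-map⁺ (renameItem σ) m)

  rename-premise : ∀ {α w v φ ψ Γ} σ v′ Ξ → Fresh v (lab w ψ ∷ Γ) →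
    rename (update σ v v′) (rel α w v ∷ lab v φ ∷ Γ) ++ Ξ ≡ rel α (σ w) v′ ∷ lab v′ φ ∷ rename σ Γ ++ Ξ
  rename-premise {α} {w} {v} {φ} {Γ = Γ} σ v′ Ξ fr =
    premise-≡ (update-other σ v v′ w (fresh≢label fr #0)) (update-same σ v v′)
              (cong (_++ Ξ) (rename-update-fresh σ v v′ Γ (λ o → fr (there o))))
    where
      premise-≡ : ∀ {a a′ b b′ L L′} → a ≡ a′ → b ≡ b′ → L ≡ L′ →
                  rel α a b ∷ lab b φ ∷ L ≡ rel α a′ b′ ∷ lab b′ φ ∷ L′
      premise-≡ refl refl refl = refl

  ioaAtoms : (Fin n → ℕ) → ℕ → Seq n
  ioaAtoms u v = tabulate (λ i → rel (rag i) (u i) v)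

  rename-ioaAtoms : ∀ σ (u : Fin n → ℕ) v Γ Ξ v′ → Fresh v Γ → (∀ i → v ≢ u i) →
    rename (update σ v v′) (ioaAtoms u v ++ Γ) ++ Ξ ≡ ioaAtoms (λ i → σ (u i)) v′ ++ rename σ Γ ++ Ξ
  rename-ioaAtoms σ u v Γ Ξ v′ fr v≢u = begin
    rename σ′ (ioaAtoms u v ++ Γ) ++ Ξ
      ≡⟨ cong (_++ Ξ) (Listₚ.map-++ (renameItem σ′) (ioaAtoms u v) Γ) ⟩
    (rename σ′ (ioaAtoms u v) ++ rename σ′ Γ) ++ Ξ
      ≡⟨ Listₚ.++-assoc (rename σ′ (ioaAtoms u v)) (rename σ′ Γ) Ξ ⟩
    rename σ′ (ioaAtoms u v) ++ rename σ′ Γ ++ Ξ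
      ≡⟨ cong₂ _++_ atoms (cong (_++ Ξ) (rename-update-fresh σ v v′ Γ fr)) ⟩
    ioaAtoms (λ i → σ (u i)) v′ ++ rename σ Γ ++ Ξ ∎
    where
      open ≡-Reasoning
      σ′ = update σ v v′
      atoms : rename σ′ (ioaAtoms u v) ≡ ioaAtoms (λ i → σ (u i)) v′
      atoms = trans (Listₚ.map-tabulate (λ i → rel (rag i) (u i) v) (renameItem σ′))
                (Listₚ.tabulate-cong (λ i → cong₂ (rel (rag i))
                   (update-other σ v v′ (u i) (v≢u i)) (update-same σ v v′)))

  -- Eigenlabels of the renamed derivation are chosen fresh again; in the
  -- (□)/([i]) case the premise is renamed with its eigenlabel sent to v′.
  mutual
    rename-weaken : ∀ {Δ : Seq n} → G3 Δ → ∀ σ Ξ → G3 (rename σ Δ ++ Ξ)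
    rename-weaken (perm p d) σ Ξ = perm (++⁺ʳ Ξ (map⁺ (renameItem σ) p)) (rename-weaken d σ Ξ)
    rename-weaken (id w p) σ Ξ = id (σ w) p
    rename-weaken (∧R w φ ψ d₁ d₂) σ Ξ = ∧R (σ w) φ ψ (rename-weaken d₁ σ Ξ) (rename-weaken d₂ σ Ξ)
    rename-weaken (∨R w φ ψ d) σ Ξ = ∨R (σ w) φ ψ (rename-weaken d σ Ξ)
    rename-weaken (□R {Γ} w v φ fr d) σ Ξ = □R (σ w) v′ φ (fresh-Fresh _) (rename-eigenlabel v′ fr d σ Ξ)
      where v′ = fresh (lab (σ w) (□ φ) ∷ rename σ Γ ++ Ξ)
    rename-weaken ([i]R {Γ} i w v φ fr d) σ Ξ = [i]R i (σ w) v′ φ (fresh-Fresh _) (rename-eigenlabel v′ fr d σ Ξ)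
      where v′ = fresh (lab (σ w) ([ i ] φ) ∷ rename σ Γ ++ Ξ)
    rename-weaken (◇R w u φ m₁ m₂ d) σ Ξ =
      ◇R (σ w) (σ u) φ (∈-rename σ Ξ m₁) (∈-rename σ Ξ m₂) (rename-weaken d σ Ξ)
    rename-weaken (⟨i⟩R i w u φ m₁ m₂ d) σ Ξ =
      ⟨i⟩R i (σ w) (σ u) φ (∈-rename σ Ξ m₁) (∈-rename σ Ξ m₂) (rename-weaken d σ Ξ)
    rename-weaken (refl□ w d) σ Ξ = refl□ (σ w) (rename-weaken d σ Ξ)
    rename-weaken (refl[i] i w d) σ Ξ = refl[i] i (σ w) (rename-weaken d σ Ξ)
    rename-weaken (IOA {Γ} w u v m fr d) σ Ξ =
      IOA (σ w) (λ i → σ (u i)) v′ (λ i → ∈-rename σ Ξ (m i)) (fresh-Fresh _)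
        (subst G3 (rename-ioaAtoms σ u v Γ Ξ v′ fr (λ i → fresh≢target fr (m i)))
                  (rename-weaken d (update σ v v′) Ξ))
      where v′ = fresh (rename σ Γ ++ Ξ)
    rename-weaken (eucl□ w u v m₁ m₂ d) σ Ξ =
      eucl□ (σ w) (σ u) (σ v) (∈-rename σ Ξ m₁) (∈-rename σ Ξ m₂) (rename-weaken d σ Ξ)
    rename-weaken (br[i] i w u m d) σ Ξ = br[i] i (σ w) (σ u) (∈-rename σ Ξ m) (rename-weaken d σ Ξ)
    rename-weaken (eucl[i] i w u v m₁ m₂ d) σ Ξ =
      eucl[i] i (σ w) (σ u) (σ v) (∈-rename σ Ξ m₁) (∈-rename σ Ξ m₂) (rename-weaken d σ Ξ)

    rename-eigenlabel : ∀ {α w v φ ψ Θ} u → Fresh v (lab w ψ ∷ Θ) → G3 (rel α w v ∷ lab v φ ∷ Θ) →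
                        ∀ σ Ξ → G3 (rel α (σ w) u ∷ lab u φ ∷ rename σ Θ ++ Ξ)
    rename-eigenlabel {v = v} u fr d σ Ξ = subst G3 (rename-premise σ u Ξ fr) (rename-weaken d (update σ v u) Ξ)

  weaken : ∀ {Γ : Seq n} → G3 Γ → ∀ Ξ → G3 (Ξ ++ Γ)
  weaken {Γ} d Ξ = perm (++-comm Γ Ξ) (subst G3 (cong (_++ Ξ) (rename-id Γ)) (rename-weaken d (λ x → x) Ξ))

  weaken₁ : ∀ {Γ : Seq n} → G3 Γ → ∀ a → G3 (a ∷ Γ)
  weaken₁ d a = weaken d (a ∷ [])

  -- Invertibility of the rules for ∧, ∨, □ and [i]

  -- Formulas whose right rule is invertible; the others (literals, ◇, ⟨i⟩)
  -- are called passive.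
  Invertible : Fm n → Set
  Invertible (_ ∧ _) = ⊤
  Invertible (_ ∨ _) = ⊤
  Invertible (□ _) = ⊤
  Invertible ([ _ ] _) = ⊤
  Invertible _ = ⊥

  invertible-along : ∀ {w x} {A B : Fm n} → lab w A ≡ lab x B → Invertible A → Invertible B
  invertible-along refl inv = inv

  -- Generic inversion of an invertible formula x : A.  `Out y' is what x : A is
  -- replaced by when its label is renamed to y; the four handlers treat a
  -- derivation whose last rule has x : A principal.  Since the inverted
  -- derivation may need eigenlabels clashing with those of Out, the statement
  -- is proved for every renaming σ and weakening Ξ.
  module Inversion (x : ℕ) (A : Fm n) (inv : Invertible A) (Out : ℕ → Seq n)
    (at-∧ : ∀ {w φ ψ Θ} → lab w (φ ∧ ψ) ≡ lab x A → G3 (lab w φ ∷ Θ) → G3 (lab w ψ ∷ Θ) →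
            ∀ σ Ξ → G3 (Out (σ x) ++ rename σ Θ ++ Ξ))
    (at-∨ : ∀ {w φ ψ Θ} → lab w (φ ∨ ψ) ≡ lab x A → G3 (lab w φ ∷ lab w ψ ∷ Θ) →
            ∀ σ Ξ → G3 (Out (σ x) ++ rename σ Θ ++ Ξ))
    (at-□ : ∀ {w v φ Θ} → lab w (□ φ) ≡ lab x A → Fresh v (lab w (□ φ) ∷ Θ) →
            G3 (rel rbox w v ∷ lab v φ ∷ Θ) → ∀ σ Ξ → G3 (Out (σ x) ++ rename σ Θ ++ Ξ))
    (at-[] : ∀ {i w v φ Θ} → lab w ([ i ] φ) ≡ lab x A → Fresh v (lab w ([ i ] φ) ∷ Θ) →
            G3 (rel (rag i) w v ∷ lab v φ ∷ Θ) → ∀ σ Ξ → G3 (Out (σ x) ++ rename σ Θ ++ Ξ))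
    where

    X : Item n
    X = lab x A

    Goal : (ℕ → ℕ) → Seq n → Seq n → Set
    Goal σ Γ Ξ = G3 (Out (σ x) ++ rename σ Γ ++ Ξ)

    invertible-X : ∀ {w B} → lab w B ≡ X → Invertible B
    invertible-X e = invertible-along (sym e) inv

    permute : ∀ {σ Θ Γ Ξ} → Θ ↭ Γ → Goal σ Θ Ξ → Goal σ Γ Ξ
    permute {σ} {Ξ = Ξ} q = perm (++⁺ˡ (Out (σ x)) (++⁺ʳ Ξ (map⁺ (renameItem σ) q)))

    restore : ∀ {σ Γ H Θ′ Ξ} → Γ ↭ H ∷ Θ′ →
              G3 (renameItem σ H ∷ Out (σ x) ++ rename σ Θ′ ++ Ξ) → Goal σ Γ Ξ
    restore {σ} {Γ} {H} {Θ′} {Ξ} r =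
      perm (↭-trans (↭-sym (shift (renameItem σ H) (Out (σ x)) (rename σ Θ′ ++ Ξ)))
                    (++⁺ˡ (Out (σ x)) (++⁺ʳ Ξ (map⁺ (renameItem σ) (↭-sym r)))))

    front₁ : ∀ {y a L} → G3 (Out y ++ a ∷ L) → G3 (a ∷ Out y ++ L)
    front₁ {y} {a} {L} = perm (shift a (Out y) L)

    front₂ : ∀ {y a b L} → G3 (Out y ++ a ∷ b ∷ L) → G3 (a ∷ b ∷ Out y ++ L)
    front₂ {y} {a} {b} {L} = perm (↭-trans (shift a (Out y) (b ∷ L)) (prep a (shift b (Out y) L)))

    ∈-Goal : ∀ {σ Γ Ξ a} → a ∈ Γ → renameItem σ a ∈ Out (σ x) ++ rename σ Γ ++ Ξ
    ∈-Goal {σ} {Ξ = Ξ} m = ∈-++⁺ʳ (Out (σ x)) (∈-rename σ Ξ m)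

    ∈-Goal-rel : ∀ {σ Δ Γ Ξ α w u} → rel α w u ∈ Δ → Δ ↭ X ∷ Γ →
                 renameItem σ (rel α w u) ∈ Out (σ x) ++ rename σ Γ ++ Ξ
    ∈-Goal-rel m p = ∈-Goal (rel-∈-↭ m p)

    Fresh-tail : ∀ {v Θ Θ′} → Fresh v Θ → Θ ↭ X ∷ Θ′ → Fresh v Θ′
    Fresh-tail fr q = Fresh-⊆ (∈-↭-tail q) fr

    fresh≢x : ∀ {v Θ Θ′} → Fresh v Θ → Θ ↭ X ∷ Θ′ → v ≢ x
    fresh≢x fr q = fresh≢label fr (∈-resp-↭ (↭-sym q) #0)

    -- rename-premise in the presence of Out: the eigenlabel v of a (□)/([i])
    -- step below x : A is not x, so renaming it leaves Out unchanged
    rename-Goal-premise : ∀ {α w v φ ψ Θ Θ′} σ v′ Ξ → Fresh v (lab w ψ ∷ Θ) → Θ ↭ X ∷ Θ′ →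
      Goal (update σ v v′) (rel α w v ∷ lab v φ ∷ Θ′) Ξ →
      G3 (Out (σ x) ++ rel α (σ w) v′ ∷ lab v′ φ ∷ rename σ Θ′ ++ Ξ)
    rename-Goal-premise {v = v} σ v′ Ξ fr q =
      subst G3 (cong₂ _++_ (cong Out (update-other σ v v′ x (fresh≢x (λ o → fr (there o)) q)))
                           (rename-premise σ v′ Ξ (Fresh-∷-tail fr q)))

    invert : ∀ {Δ Γ} → G3 Δ → Δ ↭ X ∷ Γ → ∀ σ Ξ → Goal σ Γ Ξ
    invert (perm q d) p σ Ξ = invert d (↭-trans q p) σ Ξ
    invert (id w q) p σ Ξ with ∈-↭-∷ #0 p | ∈-↭-∷ #1 p
    ... | inj₁ e | _ = ⊥-elim (invertible-X e)
    ... | inj₂ _ | inj₁ e = ⊥-elim (invertible-X e)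
    ... | inj₂ m₁ | inj₂ m₂ = id∈ (∈-Goal m₁) (∈-Goal m₂)
    invert (∧R w φ ψ d₁ d₂) p σ Ξ with ∷-↭-∷ p
    ... | inj₁ (e , q) = permute q (at-∧ e d₁ d₂ σ Ξ)
    ... | inj₂ (_ , q , r) =
      restore r (∧R (σ w) φ ψ (front₁ (invert d₁ (↭-under q) σ Ξ)) (front₁ (invert d₂ (↭-under q) σ Ξ)))
    invert (∨R w φ ψ d) p σ Ξ with ∷-↭-∷ p
    ... | inj₁ (e , q) = permute q (at-∨ e d σ Ξ)
    ... | inj₂ (_ , q , r) = restore r (∨R (σ w) φ ψ (front₂ (invert d (↭-under (↭-under q)) σ Ξ)))
    invert (□R w v φ fr d) p σ Ξ with ∷-↭-∷ p
    ... | inj₁ (e , q) = permute q (at-□ e fr d σ Ξ)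
    ... | inj₂ (Θ′ , q , r) = restore r (□R (σ w) v′ φ (fresh-Fresh _)
        (front₂ (rename-Goal-premise σ v′ Ξ fr q (invert d (↭-under (↭-under q)) (update σ v v′) Ξ))))
      where v′ = fresh (lab (σ w) (□ φ) ∷ Out (σ x) ++ rename σ Θ′ ++ Ξ)
    invert ([i]R i w v φ fr d) p σ Ξ with ∷-↭-∷ p
    ... | inj₁ (e , q) = permute q (at-[] e fr d σ Ξ)
    ... | inj₂ (Θ′ , q , r) = restore r ([i]R i (σ w) v′ φ (fresh-Fresh _)
        (front₂ (rename-Goal-premise σ v′ Ξ fr q (invert d (↭-under (↭-under q)) (update σ v v′) Ξ))))
      where v′ = fresh (lab (σ w) ([ i ] φ) ∷ Out (σ x) ++ rename σ Θ′ ++ Ξ)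
    invert (◇R w u φ m₁ m₂ d) p σ Ξ with ∈-↭-∷ m₂ p
    ... | inj₁ e = ⊥-elim (invertible-X e)
    ... | inj₂ m₂′ =
      ◇R (σ w) (σ u) φ (∈-Goal-rel m₁ p) (∈-Goal m₂′) (front₁ (invert d (↭-under p) σ Ξ))
    invert (⟨i⟩R i w u φ m₁ m₂ d) p σ Ξ with ∈-↭-∷ m₂ p
    ... | inj₁ e = ⊥-elim (invertible-X e)
    ... | inj₂ m₂′ =
      ⟨i⟩R i (σ w) (σ u) φ (∈-Goal-rel m₁ p) (∈-Goal m₂′) (front₁ (invert d (↭-under p) σ Ξ))
    invert (refl□ w d) p σ Ξ = refl□ (σ w) (front₁ (invert d (↭-under p) σ Ξ))
    invert (refl[i] i w d) p σ Ξ = refl[i] i (σ w) (front₁ (invert d (↭-under p) σ Ξ))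
    invert (eucl□ w u v m₁ m₂ d) p σ Ξ =
      eucl□ (σ w) (σ u) (σ v) (∈-Goal-rel m₁ p) (∈-Goal-rel m₂ p) (front₁ (invert d (↭-under p) σ Ξ))
    invert (br[i] i w u m d) p σ Ξ = br[i] i (σ w) (σ u) (∈-Goal-rel m p) (front₁ (invert d (↭-under p) σ Ξ))
    invert (eucl[i] i w u v m₁ m₂ d) p σ Ξ =
      eucl[i] i (σ w) (σ u) (σ v) (∈-Goal-rel m₁ p) (∈-Goal-rel m₂ p) (front₁ (invert d (↭-under p) σ Ξ))
    invert {Γ = Γ} (IOA w u v m fr d) p σ Ξ =
      IOA (σ w) (λ i → σ (u i)) v′ (λ i → ∈-Goal-rel (m i) p) (fresh-Fresh _)
        (perm (shifts (Out (σ x)) (ioaAtoms (λ i → σ (u i)) v′))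
              (subst G3 eq (invert d (↭-under-++ (ioaAtoms u v) p) σ′ Ξ)))
      where
        v′ = fresh (Out (σ x) ++ rename σ Γ ++ Ξ)
        σ′ = update σ v v′
        eq = cong₂ _++_ (cong Out (update-other σ v v′ x (fresh≢x fr p)))
                        (rename-ioaAtoms σ u v Γ Ξ v′ (Fresh-tail fr p) (λ i → fresh≢target fr (m i)))

    inverted : ∀ {Γ} → G3 (X ∷ Γ) → G3 (Out x ++ Γ)
    inverted {Γ} d = subst G3 (cong (Out x ++_) (trans (Listₚ.++-identityʳ _) (rename-id Γ)))
                                (invert d ↭-refl (λ z → z) [])

  -- Inversion lemmas.  When x : A is principal the premise, renamed, is the result.
  ∧-inv₁ : ∀ {x φ ψ Γ} → G3 (lab x (φ ∧ ψ) ∷ Γ) → G3 (lab x φ ∷ Γ)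
  ∧-inv₁ {x} {φ} {ψ} = Inversion.inverted x (φ ∧ ψ) tt (λ y → lab y φ ∷ [])
    (λ { refl d₁ d₂ σ Ξ → rename-weaken d₁ σ Ξ }) (λ ()) (λ ()) (λ ())

  ∧-inv₂ : ∀ {x φ ψ Γ} → G3 (lab x (φ ∧ ψ) ∷ Γ) → G3 (lab x ψ ∷ Γ)
  ∧-inv₂ {x} {φ} {ψ} = Inversion.inverted x (φ ∧ ψ) tt (λ y → lab y ψ ∷ [])
    (λ { refl d₁ d₂ σ Ξ → rename-weaken d₂ σ Ξ }) (λ ()) (λ ()) (λ ())

  ∨-inv : ∀ {x φ ψ Γ} → G3 (lab x (φ ∨ ψ) ∷ Γ) → G3 (lab x φ ∷ lab x ψ ∷ Γ)
  ∨-inv {x} {φ} {ψ} = Inversion.inverted x (φ ∨ ψ) tt (λ y → lab y φ ∷ lab y ψ ∷ [])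
    (λ ()) (λ { refl d σ Ξ → rename-weaken d σ Ξ }) (λ ()) (λ ())

  □-inv : ∀ {x φ Γ} u → G3 (lab x (□ φ) ∷ Γ) → G3 (rel rbox x u ∷ lab u φ ∷ Γ)
  □-inv {x} {φ} u = Inversion.inverted x (□ φ) tt (λ y → rel rbox y u ∷ lab u φ ∷ [])
    (λ ()) (λ ()) (λ { refl fr d → rename-eigenlabel u fr d }) (λ ())

  []-inv : ∀ {x i φ Γ} u → G3 (lab x ([ i ] φ) ∷ Γ) → G3 (rel (rag i) x u ∷ lab u φ ∷ Γ)
  []-inv {x} {i} {φ} u = Inversion.inverted x ([ i ] φ) tt (λ y → rel (rag i) y u ∷ lab u φ ∷ [])
    (λ ()) (λ ()) (λ ()) (λ { refl fr d → rename-eigenlabel u fr d })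

  -- Contraction of atomic items

  Atomic : Item n → Set
  Atomic (lab _ (var _)) = ⊤
  Atomic (lab _ (nvar _)) = ⊤
  Atomic (rel _ _ _) = ⊤
  Atomic _ = ⊥

  atomic-along : ∀ {L H : Item n} → Atomic L → H ≡ L → Atomic H
  atomic-along a refl = a

  -- A duplicate L of an atomic item already in Γ can be dropped.  Atomic
  -- items are never principal in a logical rule, so the derivation is copied
  -- with the extra copy of L removed.
  contract-↭ : ∀ {L Δ Γ} → Atomic L → L ∈ Γ → G3 Δ → Δ ↭ L ∷ Γ → G3 Γ
  contract-↭ a L∈Γ (perm q d) p = contract-↭ a L∈Γ d (↭-trans q p)
  contract-↭ a L∈Γ (id w q) p = id∈ (∈-↭-dup #0 p L∈Γ) (∈-↭-dup #1 p L∈Γ)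
  contract-↭ a L∈Γ (∧R w φ ψ d₁ d₂) p with ∷-↭-∷ p
  ... | inj₁ (e , _) = ⊥-elim (atomic-along a e)
  ... | inj₂ (_ , q , r) =
    perm (↭-sym r) (∧R w φ ψ (contract-↭ a (there L∈Θ′) d₁ (↭-under q))
                             (contract-↭ a (there L∈Θ′) d₂ (↭-under q)))
    where L∈Θ′ = ∈-↭-other L∈Γ r (atomic-along a)
  contract-↭ a L∈Γ (∨R w φ ψ d) p with ∷-↭-∷ p
  ... | inj₁ (e , _) = ⊥-elim (atomic-along a e)
  ... | inj₂ (_ , q , r) =
    perm (↭-sym r) (∨R w φ ψ (contract-↭ a (there (there L∈Θ′)) d (↭-under (↭-under q))))
    where L∈Θ′ = ∈-↭-other L∈Γ r (atomic-along a)
  contract-↭ a L∈Γ (□R w v φ fr d) p with ∷-↭-∷ p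
  ... | inj₁ (e , _) = ⊥-elim (atomic-along a e)
  ... | inj₂ (_ , q , r) =
    perm (↭-sym r) (□R w v φ (Fresh-∷-tail fr q) (contract-↭ a (there (there L∈Θ′)) d (↭-under (↭-under q))))
    where L∈Θ′ = ∈-↭-other L∈Γ r (atomic-along a)
  contract-↭ a L∈Γ ([i]R i w v φ fr d) p with ∷-↭-∷ p
  ... | inj₁ (e , _) = ⊥-elim (atomic-along a e)
  ... | inj₂ (_ , q , r) =
    perm (↭-sym r) ([i]R i w v φ (Fresh-∷-tail fr q) (contract-↭ a (there (there L∈Θ′)) d (↭-under (↭-under q))))
    where L∈Θ′ = ∈-↭-other L∈Γ r (atomic-along a)
  contract-↭ a L∈Γ (◇R w u φ m₁ m₂ d) p =
    ◇R w u φ (∈-↭-dup m₁ p L∈Γ) (∈-↭-dup m₂ p L∈Γ) (contract-↭ a (there L∈Γ) d (↭-under p))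
  contract-↭ a L∈Γ (⟨i⟩R i w u φ m₁ m₂ d) p =
    ⟨i⟩R i w u φ (∈-↭-dup m₁ p L∈Γ) (∈-↭-dup m₂ p L∈Γ) (contract-↭ a (there L∈Γ) d (↭-under p))
  contract-↭ a L∈Γ (refl□ w d) p = refl□ w (contract-↭ a (there L∈Γ) d (↭-under p))
  contract-↭ a L∈Γ (refl[i] i w d) p = refl[i] i w (contract-↭ a (there L∈Γ) d (↭-under p))
  contract-↭ a L∈Γ (IOA w u v m fr d) p =
    IOA w u v (λ i → ∈-↭-dup (m i) p L∈Γ) (Fresh-⊆ (∈-↭-tail p) fr)
      (contract-↭ a (∈-++⁺ʳ (ioaAtoms u v) L∈Γ) d (↭-under-++ (ioaAtoms u v) p))
  contract-↭ a L∈Γ (eucl□ w u v m₁ m₂ d) p =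
    eucl□ w u v (∈-↭-dup m₁ p L∈Γ) (∈-↭-dup m₂ p L∈Γ) (contract-↭ a (there L∈Γ) d (↭-under p))
  contract-↭ a L∈Γ (br[i] i w u m d) p = br[i] i w u (∈-↭-dup m p L∈Γ) (contract-↭ a (there L∈Γ) d (↭-under p))
  contract-↭ a L∈Γ (eucl[i] i w u v m₁ m₂ d) p =
    eucl[i] i w u v (∈-↭-dup m₁ p L∈Γ) (∈-↭-dup m₂ p L∈Γ) (contract-↭ a (there L∈Γ) d (↭-under p))

  contract : ∀ {L Γ} → Atomic L → L ∈ Γ → G3 (L ∷ Γ) → G3 Γ
  contract a L∈Γ d = contract-↭ a L∈Γ d ↭-refl

  -- Admissibility of cut

  -- Cut on a passive formula x : A against Y (= x : neg A), by induction on
  -- the derivation of x : A, Γ.  Rules not acting on x : A commute with the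
  -- cut; the other side is inverted to match their premises.  The handlers
  -- treat the cases where x : A is principal (an (id) leaf, or a (◇)/(⟨i⟩)
  -- step), where the actual reduction to smaller cuts happens.
  module PassiveCut (x : ℕ) (A : Fm n) (passive : ¬ Invertible A) (Y : Item n)
    (at-var : ∀ {w p Γ} → lab w (var p) ≡ lab x A → lab w (nvar p) ∈ Γ → G3 (Y ∷ Γ) → G3 Γ)
    (at-nvar : ∀ {w p Γ} → lab w (nvar p) ≡ lab x A → lab w (var p) ∈ Γ → G3 (Y ∷ Γ) → G3 Γ)
    (at-◇ : ∀ {w u φ Γ} → lab w (◇ φ) ≡ lab x A → rel rbox w u ∈ Γ → G3 (lab u φ ∷ Γ) →
            G3 (Y ∷ Γ) → G3 Γ)
    (at-⟨⟩ : ∀ {i w u φ Γ} → lab w (⟨ i ⟩ φ) ≡ lab x A → rel (rag i) w u ∈ Γ → G3 (lab u φ ∷ Γ) →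
             G3 (Y ∷ Γ) → G3 Γ)
    where

    X : Item n
    X = lab x A

    not-principal : ∀ {w B} → Invertible B → lab w B ≢ X
    not-principal inv e = passive (invertible-along e inv)

    Y-under : ∀ {Γ H Θ′} → Γ ↭ H ∷ Θ′ → G3 (Y ∷ Γ) → G3 (H ∷ Y ∷ Θ′)
    Y-under {H = H} r = perm (↭-trans (prep Y r) (swap Y H ↭-refl))

    Y-front₁ : ∀ {a L} → G3 (a ∷ Y ∷ L) → G3 (Y ∷ a ∷ L)
    Y-front₁ = perm (↭-under ↭-refl)

    Y-front₂ : ∀ {a b L} → G3 (a ∷ b ∷ Y ∷ L) → G3 (Y ∷ a ∷ b ∷ L)
    Y-front₂ = perm (↭-under (↭-under ↭-refl))

    weaken-Y : ∀ {Γ} a → G3 (Y ∷ Γ) → G3 (Y ∷ a ∷ Γ)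
    weaken-Y a e = Y-front₁ (weaken₁ e a)

    cut-passive : ∀ {Δ Γ} → G3 Δ → Δ ↭ X ∷ Γ → G3 (Y ∷ Γ) → G3 Γ
    cut-passive (perm q d) p e = cut-passive d (↭-trans q p) e
    cut-passive (id w q) p e with ∈-↭-∷ #0 p | ∈-↭-∷ #1 p
    ... | inj₁ e₁ | inj₁ e₂ with () ← trans e₁ (sym e₂)
    ... | inj₁ e₁ | inj₂ m₂ = at-var e₁ m₂ e
    ... | inj₂ m₁ | inj₁ e₂ = at-nvar e₂ m₁ e
    ... | inj₂ m₁ | inj₂ m₂ = id∈ m₁ m₂
    cut-passive (∧R w φ ψ d₁ d₂) p e with ∷-↭-∷ p
    ... | inj₁ (eq , _) = ⊥-elim (not-principal tt eq)
    ... | inj₂ (_ , q , r) = perm (↭-sym r)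
      (∧R w φ ψ (cut-passive d₁ (↭-under q) (Y-front₁ (∧-inv₁ (Y-under r e))))
                (cut-passive d₂ (↭-under q) (Y-front₁ (∧-inv₂ (Y-under r e)))))
    cut-passive (∨R w φ ψ d) p e with ∷-↭-∷ p
    ... | inj₁ (eq , _) = ⊥-elim (not-principal tt eq)
    ... | inj₂ (_ , q , r) = perm (↭-sym r)
      (∨R w φ ψ (cut-passive d (↭-under (↭-under q)) (Y-front₂ (∨-inv (Y-under r e)))))
    cut-passive (□R w v φ fr d) p e with ∷-↭-∷ p
    ... | inj₁ (eq , _) = ⊥-elim (not-principal tt eq)
    ... | inj₂ (_ , q , r) = perm (↭-sym r)
      (□R w v φ (Fresh-∷-tail fr q) (cut-passive d (↭-under (↭-under q)) (Y-front₂ (□-inv v (Y-under r e)))))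
    cut-passive ([i]R i w v φ fr d) p e with ∷-↭-∷ p
    ... | inj₁ (eq , _) = ⊥-elim (not-principal tt eq)
    ... | inj₂ (_ , q , r) = perm (↭-sym r)
      ([i]R i w v φ (Fresh-∷-tail fr q) (cut-passive d (↭-under (↭-under q)) (Y-front₂ ([]-inv v (Y-under r e)))))
    cut-passive (◇R w u φ m₁ m₂ d) p e with ∈-↭-∷ m₂ p
    ... | inj₁ eq = at-◇ eq (rel-∈-↭ m₁ p) (cut-passive d (↭-under p) (weaken-Y _ e)) e
    ... | inj₂ m₂′ = ◇R w u φ (rel-∈-↭ m₁ p) m₂′ (cut-passive d (↭-under p) (weaken-Y _ e))
    cut-passive (⟨i⟩R i w u φ m₁ m₂ d) p e with ∈-↭-∷ m₂ p
    ... | inj₁ eq = at-⟨⟩ eq (rel-∈-↭ m₁ p) (cut-passive d (↭-under p) (weaken-Y _ e)) e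
    ... | inj₂ m₂′ = ⟨i⟩R i w u φ (rel-∈-↭ m₁ p) m₂′ (cut-passive d (↭-under p) (weaken-Y _ e))
    cut-passive (refl□ w d) p e = refl□ w (cut-passive d (↭-under p) (weaken-Y _ e))
    cut-passive (refl[i] i w d) p e = refl[i] i w (cut-passive d (↭-under p) (weaken-Y _ e))
    cut-passive (IOA w u v m fr d) p e =
      IOA w u v (λ i → rel-∈-↭ (m i) p) (Fresh-⊆ (∈-↭-tail p) fr)
        (cut-passive d (↭-under-++ (ioaAtoms u v) p)
                       (perm (↭-under-++ (ioaAtoms u v) ↭-refl) (weaken e (ioaAtoms u v))))
    cut-passive (eucl□ w u v m₁ m₂ d) p e =
      eucl□ w u v (rel-∈-↭ m₁ p) (rel-∈-↭ m₂ p) (cut-passive d (↭-under p) (weaken-Y _ e))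
    cut-passive (br[i] i w u m d) p e = br[i] i w u (rel-∈-↭ m p) (cut-passive d (↭-under p) (weaken-Y _ e))
    cut-passive (eucl[i] i w u v m₁ m₂ d) p e =
      eucl[i] i w u v (rel-∈-↭ m₁ p) (rel-∈-↭ m₂ p) (cut-passive d (↭-under p) (weaken-Y _ e))

  neg-involutive : ∀ (A : Fm n) → neg (neg A) ≡ A
  neg-involutive (var p) = refl
  neg-involutive (nvar p) = refl
  neg-involutive (A ∧ B) = cong₂ _∧_ (neg-involutive A) (neg-involutive B)
  neg-involutive (A ∨ B) = cong₂ _∨_ (neg-involutive A) (neg-involutive B)
  neg-involutive (□ A) = cong □ (neg-involutive A)
  neg-involutive (◇ A) = cong ◇ (neg-involutive A)
  neg-involutive ([ i ] A) = cong [ i ] (neg-involutive A)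
  neg-involutive (⟨ i ⟩ A) = cong ⟨ i ⟩ (neg-involutive A)

  size : Fm n → ℕ
  size (var p) = 0
  size (nvar p) = 0
  size (A ∧ B) = suc (size A + size B)
  size (A ∨ B) = suc (size A + size B)
  size (□ A) = suc (size A)
  size (◇ A) = suc (size A)
  size ([ i ] A) = suc (size A)
  size (⟨ i ⟩ A) = suc (size A)

  size-neg : ∀ (A : Fm n) → size (neg A) ≡ size A
  size-neg (var p) = refl
  size-neg (nvar p) = refl
  size-neg (A ∧ B) = cong₂ (λ a b → suc (a + b)) (size-neg A) (size-neg B)
  size-neg (A ∨ B) = cong₂ (λ a b → suc (a + b)) (size-neg A) (size-neg B)
  size-neg (□ A) = cong suc (size-neg A)
  size-neg (◇ A) = cong suc (size-neg A)
  size-neg ([ i ] A) = cong suc (size-neg A)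
  size-neg (⟨ i ⟩ A) = cong suc (size-neg A)

  -- Conjunction and
  -- disjunction are decomposed by inversion; a modal cut formula is handled
  -- by a passive cut on its ◇/⟨i⟩ side, whose principal case reduces, after
  -- inverting the □/[i] side at the relevant label and contracting the
  -- duplicated relational atom, to a cut on the immediate subformula.
  mutual
    cut-≤ : ∀ k (A : Fm n) → size A ≤ k → ∀ {x Γ} → G3 (lab x A ∷ Γ) → G3 (lab x (neg A) ∷ Γ) → G3 Γ
    cut-≤ k (var p) _ {x} d e = PassiveCut.cut-passive x (var p) (λ ()) (lab x (nvar p))
      (λ { refl m e′ → contract tt m e′ }) (λ ()) (λ ()) (λ ()) d ↭-refl e
    cut-≤ k (nvar p) _ d e = cut-≤ k (var p) z≤n e d
    cut-≤ (suc k) (φ ∧ ψ) (s≤s le) d e =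
      cut-≤ k ψ (ℕₚ.m+n≤o⇒n≤o (size φ) le) (∧-inv₂ d)
        (cut-≤ k φ (ℕₚ.m+n≤o⇒m≤o (size φ) le) (perm (swap _ _ ↭-refl) (weaken₁ (∧-inv₁ d) _)) (∨-inv e))
    cut-≤ (suc k) (φ ∨ ψ) (s≤s le) d e =
      cut-≤ k φ (ℕₚ.m+n≤o⇒m≤o (size φ) le)
        (cut-≤ k ψ (ℕₚ.m+n≤o⇒n≤o (size φ) le) (perm (swap _ _ ↭-refl) (∨-inv d))
                                              (perm (swap _ _ ↭-refl) (weaken₁ (∧-inv₂ e) _)))
        (∧-inv₁ e)
    cut-≤ k (□ φ) le d e =
      cut-◇ k (neg φ) (subst (λ s → suc s ≤ k) (sym (size-neg φ)) le) e
        (subst (λ B → G3 (lab _ (□ B) ∷ _)) (sym (neg-involutive φ)) d)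
    cut-≤ k (◇ φ) le d e = cut-◇ k φ le d e
    cut-≤ k ([ i ] φ) le d e =
      cut-⟨⟩ k i (neg φ) (subst (λ s → suc s ≤ k) (sym (size-neg φ)) le) e
        (subst (λ B → G3 (lab _ ([ i ] B) ∷ _)) (sym (neg-involutive φ)) d)
    cut-≤ k (⟨ i ⟩ φ) le d e = cut-⟨⟩ k i φ le d e

    cut-◇ : ∀ k (φ : Fm n) → suc (size φ) ≤ k → ∀ {x Γ} →
            G3 (lab x (◇ φ) ∷ Γ) → G3 (lab x (□ (neg φ)) ∷ Γ) → G3 Γ
    cut-◇ (suc k) φ (s≤s le) {x} d e = PassiveCut.cut-passive x (◇ φ) (λ ()) (lab x (□ (neg φ)))
      (λ ()) (λ ())
      (λ { {u = u} refl R□xu d′ e′ → cut-≤ k φ le d′ (contract tt (there R□xu) (□-inv u e′)) })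
      (λ ()) d ↭-refl e

    cut-⟨⟩ : ∀ k i (φ : Fm n) → suc (size φ) ≤ k → ∀ {x Γ} →
             G3 (lab x (⟨ i ⟩ φ) ∷ Γ) → G3 (lab x ([ i ] (neg φ)) ∷ Γ) → G3 Γ
    cut-⟨⟩ (suc k) i φ (s≤s le) {x} d e = PassiveCut.cut-passive x (⟨ i ⟩ φ) (λ ()) (lab x ([ i ] (neg φ)))
      (λ ()) (λ ()) (λ ())
      (λ { {u = u} refl Rᵢxu d′ e′ → cut-≤ k φ le d′ (contract tt (there Rᵢxu) ([]-inv u e′)) })
      d ↭-refl e

  cut : ∀ (A : Fm n) {x Γ} → G3 (lab x A ∷ Γ) → G3 (lab x (neg A) ∷ Γ) → G3 Γ
  cut A = cut-≤ (size A) A ℕₚ.≤-refl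

  modus-ponens : ∀ {x} {φ ψ : Fm n} → G3 (lab x (φ ⇒ ψ) ∷ []) → G3 (lab x φ ∷ []) → G3 (lab x ψ ∷ [])
  modus-ponens {φ = φ} d e = cut φ (perm (swap _ _ ↭-refl) (weaken₁ e _)) (∨-inv d)

  neg-≢ : ∀ (A : Fm n) {w} → lab w A ≢ lab w (neg A)
  neg-≢ (var p) ()
  neg-≢ (nvar p) ()
  neg-≢ (A ∧ B) ()
  neg-≢ (A ∨ B) ()
  neg-≢ (□ A) ()
  neg-≢ (◇ A) ()
  neg-≢ ([ i ] A) ()
  neg-≢ (⟨ i ⟩ A) ()

  -- Every sequent containing x : A and x : neg A is derivable, by induction
  -- on A; the modal cases use the eigenlabel of the box for the diamond.
  mutual
    identity∈ : ∀ {Γ w} (A : Fm n) → lab w A ∈ Γ → lab w (neg A) ∈ Γ → G3 Γ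
    identity∈ A m₁ m₂ with ∈-resp-↭ (remove-↭ m₁) m₂
    ... | here e = ⊥-elim (neg-≢ A (sym e))
    ... | there m′ = perm (↭-sym (↭-trans (remove-↭ m₁) (prep _ (remove-↭ m′)))) (identity A _ _)

    identity : ∀ (A : Fm n) w Γ → G3 (lab w A ∷ lab w (neg A) ∷ Γ)
    identity (var p) w Γ = id w p
    identity (nvar p) w Γ = perm (swap _ _ ↭-refl) (id w p)
    identity (A ∧ B) w Γ = ∧R∈ #0 (∨R∈ #1 (identity∈ A #2 #0)) (∨R∈ #1 (identity∈ B #2 #1))
    identity (A ∨ B) w Γ = ∨R∈ #0 (∧R∈ #2 (identity∈ A #1 #0) (identity∈ B #2 #0))
    identity (□ A) w Γ = □R∈ #0 λ v → ◇R w v (neg A) #0 #2 (identity∈ A #2 #0)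
    identity (◇ A) w Γ = □R∈ #1 λ v → ◇R w v A #0 #2 (identity∈ A #0 #2)
    identity ([ i ] A) w Γ = [i]R∈ #0 λ v → ⟨i⟩R i w v (neg A) #0 #2 (identity∈ A #2 #0)
    identity (⟨ i ⟩ A) w Γ = [i]R∈ #1 λ v → ⟨i⟩R i w v A #0 #2 (identity∈ A #0 #2)

  axiom1 : ∀ x (φ ψ : Fm n) → G3 (lab x (φ ⇒ (ψ ⇒ φ)) ∷ [])
  axiom1 x φ ψ = ∨R∈ #0 (∨R∈ #1 (identity∈ φ #1 #2))

  axiom2 : ∀ x (φ ψ : Fm n) → G3 (lab x ((neg ψ ⇒ neg φ) ⇒ (φ ⇒ ψ)) ∷ [])
  axiom2 x φ ψ = ∨R∈ #0 (∨R∈ #1 (∧R∈ #2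
                   (identity∈ ψ #2 (∈-≡ (cong (lab x) (neg-involutive (neg ψ))) #0))
                   (identity∈ (neg φ) #1 #0)))

  axiom3 : ∀ x (φ ψ χ : Fm n) → G3 (lab x ((φ ⇒ (ψ ⇒ χ)) ⇒ ((φ ⇒ ψ) ⇒ (φ ⇒ χ))) ∷ [])
  axiom3 x φ ψ χ = ∨R∈ #0 (∨R∈ #1 (∨R∈ #1 (∧R∈ #3
                     (identity∈ (neg φ) #1 #0)
                     (∧R∈ #0 (∧R∈ #3 (identity∈ (neg φ) #2 #0) (identity∈ (neg ψ) #0 #1))
                             (identity∈ χ #2 #0)))))

  axiomT□ : ∀ x (φ : Fm n) → G3 (lab x (□ φ ⇒ φ) ∷ [])
  axiomT□ x φ = ∨R∈ #0 (refl□ x (◇R x x (neg φ) #0 #1 (identity∈ φ #3 #0)))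

  axiomTi : ∀ x i (φ : Fm n) → G3 (lab x ([ i ] φ ⇒ φ) ∷ [])
  axiomTi x i φ = ∨R∈ #0 (refl[i] i x (⟨i⟩R i x x (neg φ) #0 #1 (identity∈ φ #3 #0)))

  axiom5□ : ∀ x (φ : Fm n) → G3 (lab x (◇ φ ⇒ □ (◇ φ)) ∷ [])
  axiom5□ x φ = ∨R∈ #0 (□R∈ #1 λ v → □R∈ #2 λ u →
                  eucl□ x v u #2 #0 (◇R v u φ #0 #4 (identity∈ φ #0 #3)))

  axiom5i : ∀ x i (φ : Fm n) → G3 (lab x (⟨ i ⟩ φ ⇒ [ i ] (⟨ i ⟩ φ)) ∷ [])
  axiom5i x i φ = ∨R∈ #0 ([i]R∈ #1 λ v → [i]R∈ #2 λ u →
                    eucl[i] i x v u #2 #0 (⟨i⟩R i v u φ #0 #4 (identity∈ φ #0 #3)))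

  axiomK□ : ∀ x (φ ψ : Fm n) → G3 (lab x (□ (φ ⇒ ψ) ⇒ (□ φ ⇒ □ ψ)) ∷ [])
  axiomK□ x φ ψ = ∨R∈ #0 (∨R∈ #1 (□R∈ #1 λ v → ◇R x v (neg (neg φ) ∧ neg ψ) #0 #3
                    (∧R∈ #0 (◇R x v (neg φ) #1 #3 (identity∈ (neg φ) #0 #1)) (identity∈ ψ #2 #0))))

  axiomKi : ∀ x i (φ ψ : Fm n) → G3 (lab x ([ i ] (φ ⇒ ψ) ⇒ ([ i ] φ ⇒ [ i ] ψ)) ∷ [])
  axiomKi x i φ ψ = ∨R∈ #0 (∨R∈ #1 ([i]R∈ #1 λ v → ⟨i⟩R i x v (neg (neg φ) ∧ neg ψ) #0 #3
                      (∧R∈ #0 (⟨i⟩R i x v (neg φ) #1 #3 (identity∈ (neg φ) #0 #1)) (identity∈ ψ #2 #0))))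

  axiomD□ : ∀ x (φ : Fm n) → G3 (lab x (□ φ ∨ ◇ (neg φ)) ∷ [])
  axiomD□ x φ = ∨R∈ #0 (□R∈ #0 λ v → ◇R x v (neg φ) #0 #2 (identity∈ φ #2 #0))

  axiomDi : ∀ x i (φ : Fm n) → G3 (lab x ([ i ] φ ∨ ⟨ i ⟩ (neg φ)) ∷ [])
  axiomDi x i φ = ∨R∈ #0 ([i]R∈ #0 λ v → ⟨i⟩R i x v (neg φ) #0 #2 (identity∈ φ #2 #0))

  axiomSett : ∀ x i (φ : Fm n) → G3 (lab x (□ φ ⇒ [ i ] φ) ∷ [])
  axiomSett x i φ = ∨R∈ #0 ([i]R∈ #1 λ v → br[i] i x v #0 (◇R x v (neg φ) #0 #3 (identity∈ φ #3 #0)))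

  bigAnd-R : ∀ {Γ : Seq n} {v} k (f : Fin k → Fm n) → (∀ j → G3 (lab v (f j) ∷ Γ)) →
             G3 (lab v (bigAnd k f) ∷ Γ)
  bigAnd-R zero f D = ∨R _ _ _ (id _ 0)
  bigAnd-R (suc zero) f D = D fzero
  bigAnd-R (suc (suc k)) f D = ∧R _ _ _ (D fzero) (bigAnd-R (suc k) (λ j → f (fsuc j)) (λ j → D (fsuc j)))

  unfold-¬⋀◇ : ∀ x k (g : Fin k → Fm n) {Γ : Seq n} →
    (∀ Δ (u : Fin k → ℕ) → (∀ j → rel rbox x (u j) ∈ Δ) → (∀ j → lab (u j) (neg (g j)) ∈ Δ) →
       (∀ {a} → a ∈ Γ → a ∈ Δ) → G3 Δ) →
    G3 (lab x (neg (bigAnd k (λ j → ◇ (g j)))) ∷ Γ)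
  unfold-¬⋀◇ x zero g K = K _ (λ ()) (λ ()) (λ ()) there
  unfold-¬⋀◇ x (suc zero) g K =
    □R∈ #0 λ v → K _ (λ _ → v) (λ { fzero → #0 }) (λ { fzero → #1 }) (λ m → there (there m))
  unfold-¬⋀◇ x (suc (suc k)) g {Γ} K = ∨R∈ #0 (□R∈ #0 λ v →
    perm (↭-sym (↭-under (↭-under ↭-refl)))
      (unfold-¬⋀◇ x (suc k) (λ j → g (fsuc j)) {rel rbox x v ∷ lab v (neg (g fzero)) ∷ Γ}
        λ Δ u R□xu u:¬g Γ⊆Δ → K Δ (λ { fzero → v ; (fsuc j) → u j })
                                  (λ { fzero → Γ⊆Δ #0 ; (fsuc j) → R□xu j })
                                  (λ { fzero → Γ⊆Δ #1 ; (fsuc j) → u:¬g j })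
                                  (λ m → Γ⊆Δ (there (there m)))))

  -- Given R□ x uⱼ and uⱼ : ⟨j⟩ neg φⱼ for every
  -- agent j, the rule (IOA) supplies a fresh v with R_j uⱼ v for all j.  Using
  -- some agent i₀, v is R□-accessible from x (by (br), reflexivity and
  -- euclideanity of R□), so x : ◇ ⋀ⱼ [j]φⱼ may be instantiated at v; and for
  -- each j every R_j-successor z of v is an R_j-successor of uⱼ (reflexivity
  -- and euclideanity of R_j), so uⱼ : ⟨j⟩ neg φⱼ yields z : neg φⱼ, closing
  -- the branch for v : [j]φⱼ.
  ioa-core : Fin n → ∀ x (φs : Fin n → Fm n) Δ (u : Fin n → ℕ) →
    (∀ j → rel rbox x (u j) ∈ Δ) → (∀ j → lab (u j) (⟨ j ⟩ (neg (φs j))) ∈ Δ) →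
    lab x (◇ (bigAnd n (λ j → [ j ] (φs j)))) ∈ Δ → G3 Δ
  ioa-core i₀ x φs Δ u R□xu u:⟨⟩¬φ x:◇⋀ =
    IOA x u v R□xu (fresh-Fresh Δ)
      (br[i] i₀ (u i₀) v (Rⱼuv i₀)
        (refl□ x (eucl□ x (u i₀) x (there (there (old (R□xu i₀)))) #0
          (eucl□ (u i₀) x v #0 #2
            (◇R x v _ #0 (inΔ′ (old x:◇⋀)) (bigAnd-R n _ v-box))))))
    where
      v = fresh Δ
      Δ₁ = ioaAtoms u v ++ Δ
      old : ∀ {a} → a ∈ Δ → a ∈ Δ₁
      old = ∈-++⁺ʳ (ioaAtoms u v)
      Rⱼuv : ∀ j → rel (rag j) (u j) v ∈ Δ₁
      Rⱼuv j = ∈-++⁺ˡ (∈-tabulate⁺ {f = λ i → rel (rag i) (u i) v} j)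
      R□ : Seq n
      R□ = rel rbox x v ∷ rel rbox (u i₀) x ∷ rel rbox x x ∷ rel rbox (u i₀) v ∷ []
      inΔ′ : ∀ {a} → a ∈ Δ₁ → a ∈ R□ ++ Δ₁
      inΔ′ = ∈-++⁺ʳ R□
      v-box : ∀ j → G3 (lab v ([ j ] (φs j)) ∷ R□ ++ Δ₁)
      -- each R_j-successor z of v is also one of uⱼ, where ⟨j⟩ neg φⱼ holds
      v-box j = [i]R∈ #0 λ z →
        refl[i] j (u j) (eucl[i] j (u j) v (u j) (there (there (there (inΔ′ (Rⱼuv j))))) #0
          (eucl[i] j v (u j) z #0 #2
            (⟨i⟩R j (u j) z (neg (φs j)) #0
              (there (there (there (there (there (inΔ′ (old (u:⟨⟩¬φ j))))))))
              (identity∈ (φs j) (there #4) #0))))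

-- With no agents the axiom is ⊤ → ◇ ⊤, derivable by reflexivity of R□;
-- otherwise unfold the antecedent and apply ioa-core with the first agent.
axiomIOA : ∀ {n} x (φs : Fin n → Fm n) →
  G3 (lab x (bigAnd n (λ i → ◇ ([ i ] (φs i))) ⇒ ◇ (bigAnd n (λ i → [ i ] (φs i)))) ∷ [])
axiomIOA {zero} x φs = ∨R∈ #0 (refl□ x (◇R x x ⊤f #0 #2 (bigAnd-R 0 (λ ()) (λ ()))))
axiomIOA {suc n} x φs = ∨R∈ #0 (unfold-¬⋀◇ x (suc n) (λ i → [ i ] (φs i))
  λ Δ u R□xu u:⟨⟩¬φ Γ⊆Δ → ioa-core fzero x φs Δ u R□xu u:⟨⟩¬φ (Γ⊆Δ #0))

theorem-derivable : ∀ {n} {φ : Fm n} → Thm φ → ∀ x → G3 (lab x φ ∷ [])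
theorem-derivable (ax1 φ ψ) x = axiom1 x φ ψ
theorem-derivable (ax2 φ ψ) x = axiom2 x φ ψ
theorem-derivable (ax3 φ ψ χ) x = axiom3 x φ ψ χ
theorem-derivable (axT□ φ) x = axiomT□ x φ
theorem-derivable (ax5□ φ) x = axiom5□ x φ
theorem-derivable (axK□ φ ψ) x = axiomK□ x φ ψ
theorem-derivable (axTi i φ) x = axiomTi x i φ
theorem-derivable (ax5i i φ) x = axiom5i x i φ
theorem-derivable (axD□ φ) x = axiomD□ x φ
theorem-derivable (axDi i φ) x = axiomDi x i φ
theorem-derivable (axIOA φs) x = axiomIOA x φs
theorem-derivable (axKi i φ ψ) x = axiomKi x i φ ψ
theorem-derivable (axSett i φ) x = axiomSett x i φ
theorem-derivable (nec d) x = □R∈ #0 λ v → weaken₁ (theorem-derivable d v) _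
theorem-derivable (mp d e) x = modus-ponens (theorem-derivable d x) (theorem-derivable e x)

lemma1 : (n : ℕ) (φ : Fm n) (x : ℕ) → Thm φ → G3 (lab x φ ∷ [])
lemma1 n φ x d = theorem-derivable d x
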